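{- The class $\mathcal{C}$ of cofibrations in $\mathbf{rPres}$ is exactly the class of monomorphisms of $\mathbf{rPres}$ (i.e. morphisms injective on generators).
   Context: $\mathbf{rPres}$ is the category of reflexive presentations of monoids (generators $P_1$, relations $P_2\subseteq P_1^*\times P_1^*$ containing $u\to u$ for every word $u$; morphisms are maps on generators sending relations to relations). Let $G$ be the presentation with one generator and no relation, $G^n$ the one with $n$ generators and no relation, and $R^{m,n}$ the one with generators $a_1,\dots,a_{m+n}$ and relation $a_1\cdots a_m\to a_{m+1}\cdots a_{m+n}$. $\mathcal{I}$ is the class of inclusions $\emptyset\to G$ and $G^{m+n}\to R^{m,n}$, and $\mathcal{C}$ is the class of morphisms having the left lifting property with respect to every morphism that has the right lifting property with respect to all morphisms of $\mathcal{I}$. -}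

module Defs where

open import Level using (0ℓ)
open import Data.Empty using (⊥; ⊥-elim)
open import Data.Unit using (⊤)
open import Data.Nat using (ℕ; _+_)
open import Data.Fin using (Fin; _↑ˡ_; _↑ʳ_)
open import Data.List using (List; map; allFin)
open import Data.Sum using (_⊎_; inj₁; inj₂)
open import Data.Product using (Σ; _×_; _,_)
open import Relation.Binary.PropositionalEquality using (_≡_; refl)

-- A reflexive presentation of a monoid: a set of generators P₁ and a
-- relation P₂ ⊆ P₁* × P₁* (written Rel u v for "u → v ∈ P₂") which
-- contains u → u for every word u.
record Pres : Set₁ where
  field
    Gen      : Set
    Rel      : List Gen → List Gen → Set
    rel-refl : ∀ u → Rel u u
open Pres public

record Hom (P Q : Pres) : Set where
  field
    fun  : Gen P → Gen Q
    pres : ∀ {u v} → Rel P u v → Rel Q (map fun u) (map fun v)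
open Hom public

-- Morphisms are determined by their action on generators (P₂ is a subset).
_≈_ : ∀ {P Q} → Hom P Q → Hom P Q → Set
f ≈ g = ∀ x → fun f x ≡ fun g x

map-∘ : ∀ {A B C : Set} (g : B → C) (f : A → B) (u : List A) →
        map g (map f u) ≡ map (λ x → g (f x)) u
map-∘ g f List.[] = refl
map-∘ g f (x List.∷ u) rewrite map-∘ g f u = refl

substRel : ∀ (R : Pres) {u u′ v v′} → u ≡ u′ → v ≡ v′ → Rel R u v → Rel R u′ v′
substRel R refl refl r = r

_∘ₕ_ : ∀ {P Q R} → Hom Q R → Hom P Q → Hom P R
_∘ₕ_ {R = R} g f = record
  { fun  = λ x → fun g (fun f x)
  ; pres = λ {u} {v} r → substRel R (map-∘ (fun g) (fun f) u) (map-∘ (fun g) (fun f) v)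
                           (pres g (pres f r)) }

LLP : ∀ {A B X Y} → Hom A B → Hom X Y → Set
LLP {A} {B} {X} {Y} i p =
  (u : Hom A X) (v : Hom B Y) → (v ∘ₕ i) ≈ (p ∘ₕ u) →
  Σ (Hom B X) λ h → ((h ∘ₕ i) ≈ u) × ((p ∘ₕ h) ≈ v)

Free : Set → Pres
Free X = record { Gen = X ; Rel = _≡_ ; rel-refl = λ u → refl }

Empty : Pres
Empty = Free ⊥

G : Pres
G = Free ⊤

Gⁿ : ℕ → Pres
Gⁿ n = Free (Fin n)

-- R^{m,n}: generators a₁ … a_{m+n}, relation a₁⋯a_m → a_{m+1}⋯a_{m+n}
-- (plus the reflexive ones).
lhsWord : ∀ m n → List (Fin (m + n))
lhsWord m n = map (λ i → i ↑ˡ n) (allFin m)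

rhsWord : ∀ m n → List (Fin (m + n))
rhsWord m n = map (λ j → m ↑ʳ j) (allFin n)

R : ℕ → ℕ → Pres
R m n = record
  { Gen = Fin (m + n)
  ; Rel = λ u v → (u ≡ v) ⊎ ((u ≡ lhsWord m n) × (v ≡ rhsWord m n))
  ; rel-refl = λ u → inj₁ refl }

ι∅ : Hom Empty G
ι∅ = record { fun = ⊥-elim ; pres = λ { refl → refl } }

ιR : ∀ m n → Hom (Gⁿ (m + n)) (R m n)
ιR m n = record { fun = λ x → x ; pres = λ { {u} refl → inj₁ refl } }

RLP-𝓘 : ∀ {X Y} → Hom X Y → Set
RLP-𝓘 p = LLP ι∅ p × (∀ m n → LLP (ιR m n) p)

Cofibration : ∀ {A B} → Hom A B → Set₁
Cofibration i = ∀ {X Y} (p : Hom X Y) → RLP-𝓘 p → LLP i p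

Mono : ∀ {A B} → Hom A B → Set
Mono i = ∀ x y → fun i x ≡ fun i y → x ≡ y

{-# OPTIONS --safe #-}
module Submission where

open import Defs
open import Level using (0ℓ)
open import Axiom.ExcludedMiddle using (ExcludedMiddle)
open import Function.Base using (id; _∘_)
open import Function.Bundles using (_⇔_; mk⇔)
open import Function.Definitions using (StrictlySurjective)
open import Data.Empty using (⊥-elim)
open import Data.Unit using (⊤; tt)
open import Data.Maybe using (Maybe; just; nothing)
open import Data.Maybe.Properties using (just-injective)
open import Data.Nat using (_+_)
open import Data.Fin using (Fin; splitAt; _↑ˡ_; _↑ʳ_)
open import Data.Fin.Properties using (splitAt-↑ˡ; splitAt-↑ʳ)
open import Data.List using (List; map; allFin; length; lookup)
import Data.List.Properties as List
open import Data.Sum using (inj₁; inj₂; [_,_])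
open import Data.Product using (∃; _,_; proj₁; proj₂)
open import Relation.Nullary using (yes; no)
open import Relation.Binary.PropositionalEquality using (_≡_; refl; sym; trans; cong; module ≡-Reasoning)

-- A cofibration must be injective: lift it against the map from the
-- chaotic presentation on Maybe (Gen A) to the chaotic presentation on ⊤, which
-- has the RLP w.r.t. 𝓘 because chaotic presentations impose no constraint on
-- relations. Conversely, the RLP w.r.t. ∅ → G says that p is surjective on
-- generators, and the RLP w.r.t. all Gᵐ⁺ⁿ → Rᵐⁿ says that p reflects relations:
-- a relation between the images of two words already holds between the words.
-- Given a lifting square under a monomorphism i, define the lift as u on the
-- image of i (deciding membership by excluded middle) and as any p-preimage of v
-- elsewhere; it preserves relations because p reflects them.

Chaotic : Set → Pres
Chaotic X = record { Gen = X ; Rel = λ _ _ → ⊤ ; rel-refl = λ _ → tt }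

toChaotic : ∀ {P X} → (Gen P → X) → Hom P (Chaotic X)
toChaotic f = record { fun = f ; pres = λ _ → tt }

fromFree : ∀ {X} P → (X → Gen P) → Hom (Free X) P
fromFree P f = record { fun = f ; pres = λ { refl → rel-refl P _ } }

surjective-chaotic-RLP-𝓘 : ∀ {X Y} (f : X → Y) → StrictlySurjective _≡_ f →
                           RLP-𝓘 (toChaotic {Chaotic X} f)
surjective-chaotic-RLP-𝓘 f surj =
  (λ u v _ → toChaotic (λ _ → proj₁ (surj (fun v tt))) , (λ ()) , (λ _ → proj₂ (surj (fun v tt))))
  , λ m n u v v∘ι≈p∘u → toChaotic (fun u) , (λ _ → refl) , λ x → sym (v∘ι≈p∘u x)

cofibration⇒mono : ∀ {A B} (i : Hom A B) → Cofibration i → Mono i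
cofibration⇒mono {A} i cof x y ix≡iy = just-injective (begin
  just x             ≡⟨ sym (h∘i≈just x) ⟩
  fun h (fun i x)    ≡⟨ cong (fun h) ix≡iy ⟩
  fun h (fun i y)    ≡⟨ h∘i≈just y ⟩
  just y             ∎)
  where
    open ≡-Reasoning
    terminal : Maybe (Gen A) → ⊤
    terminal _ = tt

    -- Maybe makes the source inhabited, so the map to ⊤ is surjective.
    lift = cof (toChaotic terminal)
               (surjective-chaotic-RLP-𝓘 terminal (λ _ → nothing , refl))
               (toChaotic just) (toChaotic λ _ → tt) (λ _ → refl)
    h = proj₁ lift
    h∘i≈just = proj₁ (proj₂ lift)

RLP-ι∅⇒surjective : ∀ {X Y} (p : Hom X Y) → LLP ι∅ p → StrictlySurjective _≡_ (fun p)
RLP-ι∅⇒surjective {X} {Y} p lifts y = fun h tt , p∘h≈point tt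
  where
    lift = lifts (fromFree X ⊥-elim) (fromFree Y λ _ → y) (λ ())
    h = proj₁ lift
    p∘h≈point = proj₂ (proj₂ lift)

ReflectsRel : ∀ {X Y} → Hom X Y → Set
ReflectsRel {X} {Y} p = ∀ w w′ → Rel Y (map (fun p) w) (map (fun p) w′) → Rel X w w′

-- Labels the generators of R (length w) (length w′) so that lhsWord spells w
-- and rhsWord spells w′.
lookup-pair : ∀ {A : Set} (w w′ : List A) → Fin (length w + length w′) → A
lookup-pair w w′ k = [ lookup w , lookup w′ ] (splitAt (length w) k)

module _ {A : Set} (w w′ : List A) where

  private
    map-lookup-allFin : (v : List A) → map (lookup v) (allFin (length v)) ≡ v
    map-lookup-allFin v = trans (List.map-tabulate id (lookup v)) (List.tabulate-lookup v)

  map-lookup-pair-lhsWord : map (lookup-pair w w′) (lhsWord (length w) (length w′)) ≡ w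
  map-lookup-pair-lhsWord = begin
    map (lookup-pair w w′) (map (_↑ˡ length w′) (allFin (length w)))
      ≡⟨ sym (List.map-∘ (allFin (length w))) ⟩
    map (lookup-pair w w′ ∘ (_↑ˡ length w′)) (allFin (length w))
      ≡⟨ List.map-cong (λ k → cong [ lookup w , lookup w′ ] (splitAt-↑ˡ (length w) k (length w′))) _ ⟩
    map (lookup w) (allFin (length w))
      ≡⟨ map-lookup-allFin w ⟩
    w ∎
    where open ≡-Reasoning

  map-lookup-pair-rhsWord : map (lookup-pair w w′) (rhsWord (length w) (length w′)) ≡ w′
  map-lookup-pair-rhsWord = begin
    map (lookup-pair w w′) (map (length w ↑ʳ_) (allFin (length w′)))
      ≡⟨ sym (List.map-∘ (allFin (length w′))) ⟩
    map (lookup-pair w w′ ∘ (length w ↑ʳ_)) (allFin (length w′))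
      ≡⟨ List.map-cong (λ k → cong [ lookup w , lookup w′ ] (splitAt-↑ʳ (length w) (length w′) k)) _ ⟩
    map (lookup w′) (allFin (length w′))
      ≡⟨ map-lookup-allFin w′ ⟩
    w′ ∎
    where open ≡-Reasoning

RLP-ιR⇒reflectsRel : ∀ {X Y} (p : Hom X Y) → (∀ m n → LLP (ιR m n) p) → ReflectsRel p
RLP-ιR⇒reflectsRel {X} {Y} p lifts w w′ r =
  substRel X (h-maps-to w (map-lookup-pair-lhsWord w w′)) (h-maps-to w′ (map-lookup-pair-rhsWord w w′))
             (pres h (inj₂ (refl , refl)))
  where
    m = length w
    n = length w′
    f = lookup-pair w w′

    p∘f-maps-to : ∀ {z} v → map f z ≡ v → map (fun p) v ≡ map (fun p ∘ f) z
    p∘f-maps-to {z} v f[z]≡v = trans (cong (map (fun p)) (sym f[z]≡v)) (sym (List.map-∘ z))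

    target : Hom (R m n) Y
    target = record
      { fun  = fun p ∘ f
      ; pres = λ { (inj₁ refl) → rel-refl Y _
                 ; (inj₂ (refl , refl)) →
                     substRel Y (p∘f-maps-to w (map-lookup-pair-lhsWord w w′))
                                (p∘f-maps-to w′ (map-lookup-pair-rhsWord w w′)) r } }

    lift = lifts m n (fromFree X f) target (λ _ → refl)
    h = proj₁ lift
    h≈f = proj₁ (proj₂ lift)

    h-maps-to : ∀ {z} v → (map f z ≡ v) → map (fun h) z ≡ v
    h-maps-to {z} v f[z]≡v = trans (List.map-cong h≈f z) (f[z]≡v)

homOver : ∀ {B X Y} (p : Hom X Y) (v : Hom B Y) → ReflectsRel p →
          (f : Gen B → Gen X) → (∀ b → fun p (f b) ≡ fun v b) → Hom B X
homOver {B} {X} {Y} p v reflects f p∘f≈v = record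
  { fun  = f
  ; pres = λ {w} {w′} r → reflects (map f w) (map f w′)
                            (substRel Y (v-as-p∘f w) (v-as-p∘f w′) (pres v r)) }
  where
    v-as-p∘f : ∀ w → map (fun v) w ≡ map (fun p) (map f w)
    v-as-p∘f w = trans (sym (List.map-cong p∘f≈v w)) (List.map-∘ w)

mono⇒cofibration : ExcludedMiddle 0ℓ → ∀ {A B} (i : Hom A B) → Mono i → Cofibration i
mono⇒cofibration em {A} {B} i mono {X} p (lifts∅ , liftsR) u v v∘i≈p∘u =
  homOver p v (RLP-ιR⇒reflectsRel p liftsR) lift p∘lift≈v , lift∘i≈u , p∘lift≈v
  where
    surjective = RLP-ι∅⇒surjective p lifts∅

    lift : Gen B → Gen X
    lift b with em {∃ λ a → fun i a ≡ b}
    ... | yes (a , _) = fun u a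
    ... | no _        = proj₁ (surjective (fun v b))

    p∘lift≈v : ∀ b → fun p (lift b) ≡ fun v b
    p∘lift≈v b with em {∃ λ a → fun i a ≡ b}
    ... | yes (a , ia≡b) = trans (sym (v∘i≈p∘u a)) (cong (fun v) ia≡b)
    ... | no _           = proj₂ (surjective (fun v b))

    lift∘i≈u : ∀ a → lift (fun i a) ≡ fun u a
    lift∘i≈u a with em {∃ λ a′ → fun i a′ ≡ fun i a}
    ... | yes (a′ , ia′≡ia) = cong (fun u) (mono a′ a ia′≡ia)
    ... | no ∉image         = ⊥-elim (∉image (a , refl))

mainTheorem13 : ExcludedMiddle 0ℓ → ∀ {A B : Pres} (i : Hom A B) → Cofibration i ⇔ Mono i
mainTheorem13 em i = mk⇔ (cofibration⇒mono i) (mono⇒cofibration em i)
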